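{- For every integer $n \ge 1$, the number of parity palindrome compositions of $2n$ equals $2\cdot 3^{n-1}$, and the number of parity palindrome compositions of $2n+1$ also equals $2\cdot 3^{n-1}$.
   Context: A composition of a positive integer $m$ is a finite ordered sequence $(a_1,a_2,\dots,a_k)$ of positive integers (its parts), $k\ge 1$, with $a_1+a_2+\cdots+a_k=m$. A parity palindrome composition of $m$ is a composition $(a_1,\dots,a_k)$ of $m$ such that $a_i \equiv a_{k+1-i} \pmod 2$ for every $i=1,\dots,k$, i.e., the sequence of parts reads the same forward and backward when reduced modulo $2$. For example, $(3,2,1,4,1)$ is a parity palindrome composition of $11$. -}

module Defs where

open import Data.Nat using (ℕ; zero; suc; _+_; _*_; _^_; _≤_; _%_)
open import Data.List using (List; []; _∷_; reverse; map; length)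
open import Data.Nat.ListAction using (sum)
open import Data.List.Relation.Unary.All using (All)
open import Data.List.Relation.Unary.Unique.Propositional using (Unique)
open import Data.List.Membership.Propositional using (_∈_)
open import Data.Product using (_×_; Σ)
open import Relation.Binary.PropositionalEquality using (_≡_; _≢_)
open import Function.Bundles using (_⇔_)

IsComposition : ℕ → List ℕ → Set
IsComposition m as = (as ≢ []) × All (λ a → 1 ≤ a) as × sum as ≡ m

IsParityPalindrome : List ℕ → Set
IsParityPalindrome as = map (_% 2) as ≡ reverse (map (_% 2) as)

IsPPComposition : ℕ → List ℕ → Set
IsPPComposition m as = IsComposition m as × IsParityPalindrome as

NumPPCompositions : ℕ → ℕ → Set
NumPPCompositions m c =
  Σ (List (List ℕ)) λ L →
    Unique L × (∀ as → (as ∈ L) ⇔ IsPPComposition m as) × length L ≡ c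

{-# OPTIONS --safe #-}
module Submission where

-- A parity palindrome composition with at least two parts is a ∷ mid ∷ʳ b with
-- a ≡ b (mod 2) and mid a possibly empty parity palindrome composition; call the
-- triple (a , mid , b) a frame. A frame of m + 2 with both ends at least 2 loses one
-- from each end and becomes a frame of m; if both ends are 1, mid is a parity
-- palindrome composition of m; if exactly one end is 1, the other end is at least 3
-- and loses two, giving (up to swapping the ends) a frame of m with first part 1.
-- Counting compositions q, frames w and frames starting with 1 y at m, this gives
-- w' = w + q + 2y, y' = q + y and q' = 1 + w' from m to m + 2, whence
-- q = 2·3ⁿ⁻¹ at m = 2n and m = 2n + 1.

open import Defs
open import Data.Nat using (ℕ; zero; suc; _+_; _*_; _^_; _∸_; _≤_; _<_; _%_; z≤n; s≤s)
open import Data.Nat.Properties using (<⇒≱; +-suc; +-comm; +-identityʳ; *-comm; suc-injective; ≤-trans; m≤n+m)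
open import Data.Nat.Tactic.RingSolver using (solve-∀)
open import Data.Nat.ListAction using (sum)
open import Data.Nat.ListAction.Properties using (sum-++)
open import Data.List using (List; []; _∷_; _++_; [_]; _∷ʳ_; reverse; map; length; initLast; _∷ʳ′_)
open import Data.List.Properties using (length-++; length-map; ∷-injective; ∷ʳ-injective; map-++; unfold-reverse; reverse-++; ++-conicalʳ)
open import Data.List.Relation.Unary.All using (All; []; _∷_)
open import Data.List.Relation.Unary.All.Properties using (∷ʳ⁺; ∷ʳ⁻)
open import Data.List.Relation.Unary.Any using (here; there)
open import Data.List.Relation.Unary.Unique.Propositional using (Unique)
import Data.List.Relation.Unary.Unique.Propositional.Properties as Unique
import Data.List.Relation.Unary.AllPairs as AllPairs
open import Data.List.Membership.Propositional using (_∈_)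
open import Data.List.Membership.Propositional.Properties using (∈-map⁻; ∈-map⁺; ∈-++⁻; ∈-++⁺ˡ; ∈-++⁺ʳ)
open import Data.Product using (_×_; Σ; _,_; proj₁; proj₂)
open import Data.Sum using (_⊎_; inj₁; inj₂)
import Data.Sum as Sum
open import Data.Empty using (⊥-elim)
open import Function using (_∘_)
open import Function.Bundles using (_⇔_; mk⇔; Equivalence)
open import Function.Definitions using (Injective)
import Function.Properties.Equivalence as ⇔
open import Relation.Nullary using (¬_)
open import Relation.Binary.PropositionalEquality using (_≡_; refl; sym; trans; cong; cong₂; subst; module ≡-Reasoning)

open Equivalence using (to; from)

HasSize : {A : Set} → (A → Set) → ℕ → Set
HasSize {A} P c = Σ (List A) λ L → Unique L × (∀ x → (x ∈ L) ⇔ P x) × length L ≡ c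

Image : {A B : Set} → (A → B) → (A → Set) → B → Set
Image {A} f P y = Σ A λ x → P x × y ≡ f x

module _ {A : Set} where

  HasSize-resp-⇔ : {P Q : A → Set} {c : ℕ} → (∀ x → P x ⇔ Q x) → HasSize P c → HasSize Q c
  HasSize-resp-⇔ P⇔Q (L , unique , L⇔P , len) =
    L , unique , (λ x → ⇔.trans (L⇔P x) (P⇔Q x)) , len

  HasSize-∅ : {P : A → Set} → (∀ x → ¬ P x) → HasSize P 0
  HasSize-∅ ¬P = [] , AllPairs.[] , (λ x → mk⇔ (λ ()) (⊥-elim ∘ ¬P x)) , refl

  HasSize-≡ : (a : A) → HasSize (_≡ a) 1
  HasSize-≡ a = [ a ] , [] AllPairs.∷ AllPairs.[] ,
    (λ x → mk⇔ (λ { (here x≡a) → x≡a ; (there ()) }) here) , refl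

  HasSize-⊎ : {P Q : A → Set} {c d : ℕ} → (∀ x → P x → ¬ Q x) →
              HasSize P c → HasSize Q d → HasSize (λ x → P x ⊎ Q x) (c + d)
  HasSize-⊎ disjoint (L , uL , L⇔P , lenL) (M , uM , M⇔Q , lenM) =
    L ++ M ,
    Unique.++⁺ uL uM (λ { {x} (x∈L , x∈M) → disjoint x (to (L⇔P x) x∈L) (to (M⇔Q x) x∈M) }) ,
    (λ x → mk⇔ (Sum.map (to (L⇔P x)) (to (M⇔Q x)) ∘ ∈-++⁻ L)
               (Sum.[ ∈-++⁺ˡ ∘ from (L⇔P x) , ∈-++⁺ʳ L ∘ from (M⇔Q x) ])) ,
    trans (length-++ L) (cong₂ _+_ lenL lenM)

  HasSize-image : {B : Set} {P : A → Set} {c : ℕ} (f : A → B) → Injective _≡_ _≡_ f →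
                  HasSize P c → HasSize (Image f P) c
  HasSize-image f f-inj (L , unique , L⇔P , len) =
    map f L , Unique.map⁺ f-inj unique ,
    (λ y → mk⇔ (λ y∈fL → let (x , x∈L , y≡fx) = ∈-map⁻ f y∈fL in x , to (L⇔P x) x∈L , y≡fx)
               (λ { (x , Px , refl) → ∈-map⁺ f (from (L⇔P x) Px) })) ,
    trans (length-map f L) len

[1+m]%2≡1∸m%2 : ∀ m → suc m % 2 ≡ 1 ∸ m % 2
[1+m]%2≡1∸m%2 zero = refl
[1+m]%2≡1∸m%2 (suc zero) = refl
[1+m]%2≡1∸m%2 (suc (suc m)) = [1+m]%2≡1∸m%2 m

%2-suc-cong : ∀ a b → a % 2 ≡ b % 2 → suc a % 2 ≡ suc b % 2
%2-suc-cong a b eq =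
  trans ([1+m]%2≡1∸m%2 a) (trans (cong (1 ∸_) eq) (sym ([1+m]%2≡1∸m%2 b)))

∷-∷ʳ-palindrome⇔ : {A : Set} (x y : A) (xs : List A) →
                   (x ∷ xs ∷ʳ y ≡ reverse (x ∷ xs ∷ʳ y)) ⇔ (x ≡ y × xs ≡ reverse xs)
∷-∷ʳ-palindrome⇔ x y xs = mk⇔ split join
  where
  reverse-∷-∷ʳ : ∀ x y → reverse (x ∷ xs ∷ʳ y) ≡ y ∷ reverse xs ∷ʳ x
  reverse-∷-∷ʳ x y = trans (unfold-reverse x (xs ∷ʳ y)) (cong (_∷ʳ x) (reverse-++ xs [ y ]))

  split : x ∷ xs ∷ʳ y ≡ reverse (x ∷ xs ∷ʳ y) → x ≡ y × xs ≡ reverse xs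
  split eq = let (x≡y , eq′) = ∷-injective (trans eq (reverse-∷-∷ʳ x y))
             in x≡y , proj₁ (∷ʳ-injective xs (reverse xs) eq′)

  join : x ≡ y × xs ≡ reverse xs → x ∷ xs ∷ʳ y ≡ reverse (x ∷ xs ∷ʳ y)
  join (refl , xs≡rev) = trans (cong (λ zs → x ∷ zs ∷ʳ x) xs≡rev) (sym (reverse-∷-∷ʳ x x))

parityPalindrome-∷-∷ʳ⇔ : ∀ a mid b →
  IsParityPalindrome (a ∷ mid ∷ʳ b) ⇔ (a % 2 ≡ b % 2 × IsParityPalindrome mid)
parityPalindrome-∷-∷ʳ⇔ a mid b =
  subst (λ ps → (ps ≡ reverse ps) ⇔ (a % 2 ≡ b % 2 × IsParityPalindrome mid)) (cong (a % 2 ∷_) (sym (map-++ (_% 2) mid [ b ])))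
        (∷-∷ʳ-palindrome⇔ (a % 2) (b % 2) (map (_% 2) mid))

-- Unlike IsPPComposition, this admits the empty list as the composition of 0.
IsPPList : ℕ → List ℕ → Set
IsPPList m as = All (1 ≤_) as × sum as ≡ m × IsParityPalindrome as

isPPComposition⇔isPPList : ∀ k as → IsPPComposition (suc k) as ⇔ IsPPList (suc k) as
isPPComposition⇔isPPList k as = mk⇔ (λ ((_ , pos , s) , pal) → pos , s , pal) nonempty
  where
  nonempty : IsPPList (suc k) as → IsPPComposition (suc k) as
  nonempty (pos , s , pal) = (nonnil as s , pos , s) , pal
    where
    nonnil : ∀ as → sum as ≡ suc k → ¬ as ≡ []
    nonnil (_ ∷ _) _ ()

Frame : Set
Frame = ℕ × List ℕ × ℕ

frame : Frame → List ℕ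
frame (a , mid , b) = a ∷ mid ∷ʳ b

IsPPFrame : ℕ → Frame → Set
IsPPFrame m (a , mid , b) =
  1 ≤ a × 1 ≤ b × a % 2 ≡ b % 2 × All (1 ≤_) mid × IsParityPalindrome mid × a + (b + sum mid) ≡ m

IsPPFrame₁ : ℕ → Frame → Set
IsPPFrame₁ m t = proj₁ t ≡ 1 × IsPPFrame m t

frame-injective : Injective _≡_ _≡_ frame
frame-injective {a , mid , b} {a′ , mid′ , b′} eq with ∷-injective eq
... | refl , eq′ with ∷ʳ-injective mid mid′ eq′
... | refl , refl = refl

sum-frame : ∀ a mid b → sum (frame (a , mid , b)) ≡ a + (b + sum mid)
sum-frame a mid b = cong (a +_) (begin
  sum (mid ++ [ b ])    ≡⟨ sum-++ mid [ b ] ⟩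
  sum mid + (b + 0)     ≡⟨ cong (sum mid +_) (+-identityʳ b) ⟩
  sum mid + b           ≡⟨ +-comm (sum mid) b ⟩
  b + sum mid           ∎)
  where open ≡-Reasoning

ppList-split : ∀ k as → IsPPList (suc k) as ⇔ (as ≡ [ suc k ] ⊎ Image frame (IsPPFrame (suc k)) as)
ppList-split k as = mk⇔ (split as) join
  where
  split : ∀ as → IsPPList (suc k) as → as ≡ [ suc k ] ⊎ Image frame (IsPPFrame (suc k)) as
  split as _ with initLast as
  split .[] (_ , () , _) | []
  split .([] ∷ʳ x) (_ , s , _) | [] ∷ʳ′ x = inj₁ (cong [_] (trans (sym (+-identityʳ x)) s))
  split .((a ∷ mid) ∷ʳ b) (pa ∷ pos , s , pal) | (a ∷ mid) ∷ʳ′ b =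
    let (pmid , pb) = ∷ʳ⁻ pos
        (a≡b , palmid) = to (parityPalindrome-∷-∷ʳ⇔ a mid b) pal
    in inj₂ ((a , mid , b) , (pa , pb , a≡b , pmid , palmid , trans (sym (sum-frame a mid b)) s) , refl)

  join : as ≡ [ suc k ] ⊎ Image frame (IsPPFrame (suc k)) as → IsPPList (suc k) as
  join (inj₁ refl) = s≤s z≤n ∷ [] , +-identityʳ (suc k) , refl
  join (inj₂ ((a , mid , b) , (pa , pb , a≡b , pmid , palmid , s) , refl)) =
    pa ∷ ∷ʳ⁺ pmid pb , trans (sum-frame a mid b) s , from (parityPalindrome-∷-∷ʳ⇔ a mid b) (a≡b , palmid)

singleton-not-frame : ∀ k as → as ≡ [ suc k ] → ¬ Image frame (IsPPFrame (suc k)) as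
singleton-not-frame k _ refl ((a , mid , b) , _ , eq) with ++-conicalʳ mid [ b ] (sym (proj₂ (∷-injective eq)))
... | ()

isPPFrame⇒2≤ : ∀ {m} t → IsPPFrame m t → 2 ≤ m
isPPFrame⇒2≤ (suc a , mid , suc b) (s≤s z≤n , s≤s z≤n , _ , _ , _ , refl) =
  s≤s (≤-trans (s≤s z≤n) (m≤n+m (suc (b + sum mid)) a))

widen : Frame → Frame
widen (a , mid , b) = suc a , mid , suc b

unitFrame : List ℕ → Frame
unitFrame mid = 1 , mid , 1

growLast : Frame → Frame
growLast (a , mid , b) = a , mid , suc (suc b)

swap : Frame → Frame
swap (a , mid , b) = b , mid , a

widen-injective : Injective _≡_ _≡_ widen
widen-injective {_ , _ , _} {_ , _ , _} refl = refl

unitFrame-injective : Injective _≡_ _≡_ unitFrame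
unitFrame-injective refl = refl

growLast-injective : Injective _≡_ _≡_ growLast
growLast-injective {_ , _ , _} {_ , _ , _} refl = refl

swap∘growLast-injective : Injective _≡_ _≡_ (swap ∘ growLast)
swap∘growLast-injective {_ , _ , _} {_ , _ , _} refl = refl

widen-isPPFrame : ∀ m t → IsPPFrame m t → IsPPFrame (2 + m) (widen t)
widen-isPPFrame m (a , mid , b) (_ , _ , a≡b , pmid , palmid , s) =
  s≤s z≤n , s≤s z≤n , %2-suc-cong a b a≡b , pmid , palmid ,
  cong suc (trans (+-suc a (b + sum mid)) (cong suc s))

unitFrame-isPPFrame : ∀ m mid → IsPPList m mid → IsPPFrame (2 + m) (unitFrame mid)
unitFrame-isPPFrame m mid (pmid , s , palmid) = s≤s z≤n , s≤s z≤n , refl , pmid , palmid , cong (2 +_) s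

growLast-isPPFrame₁ : ∀ m t → IsPPFrame₁ m t → IsPPFrame₁ (2 + m) (growLast t)
growLast-isPPFrame₁ m (.1 , mid , b) (refl , _ , _ , a≡b , pmid , palmid , s) =
  refl , s≤s z≤n , s≤s z≤n , a≡b , pmid , palmid , cong (2 +_) s

swap∘growLast-isPPFrame : ∀ m t → IsPPFrame₁ m t → IsPPFrame (2 + m) (swap (growLast t))
swap∘growLast-isPPFrame m (.1 , mid , b) (refl , _ , _ , a≡b , pmid , palmid , s) =
  s≤s z≤n , s≤s z≤n , sym a≡b , pmid , palmid , cong (2 +_) (trans (+-suc b (sum mid)) s)

FrameParts : ℕ → Frame → Set
FrameParts m t = Image widen (IsPPFrame m) t ⊎ Image unitFrame (IsPPList m) t ⊎
                 Image growLast (IsPPFrame₁ m) t ⊎ Image (swap ∘ growLast) (IsPPFrame₁ m) t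

ppFrame-split : ∀ m t → IsPPFrame (2 + m) t ⇔ FrameParts m t
ppFrame-split m t = mk⇔ (split m t) (join m t)
  where
  split : ∀ m t → IsPPFrame (2 + m) t → FrameParts m t
  split m (zero , _ , _) (() , _)
  split m (suc _ , _ , zero) (_ , () , _)
  split m (1 , mid , 1) (_ , _ , _ , pmid , palmid , refl) =
    inj₂ (inj₁ (mid , (pmid , refl , palmid) , refl))
  split m (1 , mid , 2) (_ , _ , () , _)
  split m (1 , mid , suc (suc (suc b))) (_ , _ , a≡b , pmid , palmid , refl) =
    inj₂ (inj₂ (inj₁ ((1 , mid , suc b) , (refl , s≤s z≤n , s≤s z≤n , a≡b , pmid , palmid , refl) , refl)))
  split m (2 , mid , 1) (_ , _ , () , _)
  split m (suc (suc (suc a)) , mid , 1) (_ , _ , a≡b , pmid , palmid , s) =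
    inj₂ (inj₂ (inj₂ ((1 , mid , suc a) ,
      (refl , s≤s z≤n , s≤s z≤n , sym a≡b , pmid , palmid ,
       trans (cong suc (sym (+-suc a (sum mid)))) (suc-injective (suc-injective s))) , refl)))
  split m (suc (suc a) , mid , suc (suc b)) (_ , _ , a≡b , pmid , palmid , s) =
    inj₁ ((suc a , mid , suc b) ,
      (s≤s z≤n , s≤s z≤n , %2-suc-cong a b a≡b , pmid , palmid ,
       trans (sym (+-suc a (suc (b + sum mid)))) (suc-injective (suc-injective s))) , refl)

  join : ∀ m t → FrameParts m t → IsPPFrame (2 + m) t
  join m _ (inj₁ (t , P , refl)) = widen-isPPFrame m t P
  join m _ (inj₂ (inj₁ (mid , P , refl))) = unitFrame-isPPFrame m mid P
  join m _ (inj₂ (inj₂ (inj₁ (t , P , refl)))) = proj₂ (growLast-isPPFrame₁ m t P)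
  join m _ (inj₂ (inj₂ (inj₂ (t , P , refl)))) = swap∘growLast-isPPFrame m t P

ppFrame₁-split : ∀ m t →
  IsPPFrame₁ (2 + m) t ⇔ (Image unitFrame (IsPPList m) t ⊎ Image growLast (IsPPFrame₁ m) t)
ppFrame₁-split m t = mk⇔ (split t) join
  where
  split : ∀ t → IsPPFrame₁ (2 + m) t → Image unitFrame (IsPPList m) t ⊎ Image growLast (IsPPFrame₁ m) t
  split t (refl , P) with to (ppFrame-split m t) P
  ... | inj₁ ((suc _ , _ , _) , (s≤s z≤n , _) , ())
  ... | inj₂ (inj₁ unit) = inj₁ unit
  ... | inj₂ (inj₂ (inj₁ grown)) = inj₂ grown
  ... | inj₂ (inj₂ (inj₂ ((.1 , _ , _) , (refl , _) , ())))

  join : Image unitFrame (IsPPList m) t ⊎ Image growLast (IsPPFrame₁ m) t → IsPPFrame₁ (2 + m) t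
  join (inj₁ (mid , P , refl)) = refl , unitFrame-isPPFrame m mid P
  join (inj₂ (t , P , refl)) = growLast-isPPFrame₁ m t P

widen-disjoint : ∀ m t → Image widen (IsPPFrame m) t →
  ¬ (Image unitFrame (IsPPList m) t ⊎ Image growLast (IsPPFrame₁ m) t ⊎ Image (swap ∘ growLast) (IsPPFrame₁ m) t)
widen-disjoint m _ ((suc _ , _ , suc _) , (s≤s z≤n , s≤s z≤n , _) , refl) (inj₁ (_ , _ , ()))
widen-disjoint m _ ((suc _ , _ , suc _) , (s≤s z≤n , s≤s z≤n , _) , refl) (inj₂ (inj₁ ((.1 , _ , _) , (refl , _) , ())))
widen-disjoint m _ ((suc _ , _ , suc _) , (s≤s z≤n , s≤s z≤n , _) , refl) (inj₂ (inj₂ ((.1 , _ , _) , (refl , _) , ())))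

unitFrame-disjoint : ∀ m t → Image unitFrame (IsPPList m) t →
  ¬ (Image growLast (IsPPFrame₁ m) t ⊎ Image (swap ∘ growLast) (IsPPFrame₁ m) t)
unitFrame-disjoint m _ (_ , _ , refl) (inj₁ ((.1 , _ , _) , (refl , _) , ()))
unitFrame-disjoint m _ (_ , _ , refl) (inj₂ ((.1 , _ , _) , (refl , _) , ()))

growLast-disjoint : ∀ m t → Image growLast (IsPPFrame₁ m) t → ¬ Image (swap ∘ growLast) (IsPPFrame₁ m) t
growLast-disjoint m _ ((.1 , _ , _) , (refl , _) , refl) ((.1 , _ , _) , (refl , _) , ())

noPPFrame : ∀ m → m < 2 → ∀ t → ¬ IsPPFrame m t
noPPFrame m m<2 t P = <⇒≱ m<2 (isPPFrame⇒2≤ t P)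

-- Sizes at m = 2n + r for r < 2; they do not depend on r.
ppListCount ppFrameCount ppFrame₁Count : ℕ → ℕ
ppListCount zero = 1
ppListCount (suc n) = suc (ppFrameCount (suc n))
ppFrameCount zero = 0
ppFrameCount (suc n) = ppFrameCount n + (ppListCount n + (ppFrame₁Count n + ppFrame₁Count n))
ppFrame₁Count zero = 0
ppFrame₁Count (suc n) = ppListCount n + ppFrame₁Count n

Sizes : ℕ → ℕ → Set
Sizes r n = HasSize (IsPPList m) (ppListCount n) × HasSize (IsPPFrame m) (ppFrameCount n) ×
            HasSize (IsPPFrame₁ m) (ppFrame₁Count n)
  where m = n * 2 + r

sizes-base : ∀ r → r < 2 → Sizes r 0
sizes-base r r<2 = lists r r<2 , HasSize-∅ (noPPFrame r r<2) , HasSize-∅ (λ t → noPPFrame r r<2 t ∘ proj₂)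
  where
  onlyNil : ∀ as → IsPPList 0 as → as ≡ []
  onlyNil [] _ = refl
  onlyNil (suc _ ∷ _) (s≤s z≤n ∷ _ , () , _)

  lists : ∀ r → r < 2 → HasSize (IsPPList r) 1
  lists zero _ = HasSize-resp-⇔ (λ as → mk⇔ (λ { refl → [] , refl , refl }) (onlyNil as)) (HasSize-≡ [])
  lists (suc zero) 1<2 = HasSize-resp-⇔ (λ as → ⇔.sym (ppList-split 0 as))
    (HasSize-⊎ (singleton-not-frame 0) (HasSize-≡ [ 1 ])
      (HasSize-image frame frame-injective (HasSize-∅ (noPPFrame 1 1<2))))
  lists (suc (suc _)) (s≤s (s≤s ()))

sizes-suc : ∀ r n → Sizes r n → Sizes r (suc n)
sizes-suc r n (lists , frames , frames₁) = lists′ , frames′ , frames₁′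
  where
  m : ℕ
  m = n * 2 + r

  frames′ : HasSize (IsPPFrame (2 + m)) (ppFrameCount (suc n))
  frames′ = HasSize-resp-⇔ (λ t → ⇔.sym (ppFrame-split m t))
    (HasSize-⊎ (widen-disjoint m) (HasSize-image widen widen-injective frames)
      (HasSize-⊎ (unitFrame-disjoint m) (HasSize-image unitFrame unitFrame-injective lists)
        (HasSize-⊎ (growLast-disjoint m) (HasSize-image growLast growLast-injective frames₁)
          (HasSize-image (swap ∘ growLast) swap∘growLast-injective frames₁))))

  frames₁′ : HasSize (IsPPFrame₁ (2 + m)) (ppFrame₁Count (suc n))
  frames₁′ = HasSize-resp-⇔ (λ t → ⇔.sym (ppFrame₁-split m t))
    (HasSize-⊎ (λ t unit → unitFrame-disjoint m t unit ∘ inj₁)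
      (HasSize-image unitFrame unitFrame-injective lists) (HasSize-image growLast growLast-injective frames₁))

  lists′ : HasSize (IsPPList (2 + m)) (ppListCount (suc n))
  lists′ = HasSize-resp-⇔ (λ as → ⇔.sym (ppList-split (suc m) as))
    (HasSize-⊎ (singleton-not-frame (suc m)) (HasSize-≡ [ 2 + m ]) (HasSize-image frame frame-injective frames′))

sizes : ∀ r → r < 2 → ∀ n → Sizes r n
sizes r r<2 zero = sizes-base r r<2
sizes r r<2 (suc n) = sizes-suc r n (sizes r r<2 n)

counts-closed : ∀ n → ppListCount (suc n) ≡ 2 * 3 ^ n × ppFrame₁Count (suc n) ≡ 3 ^ n
counts-closed zero = refl , refl
counts-closed (suc n) with counts-closed n
... | q≡ , y≡ =
  trans (cong₂ (λ q y → q + (q + (y + y))) q≡ y≡) (six (3 ^ n)) , trans (cong₂ _+_ q≡ y≡) (three (3 ^ n))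
  where
  six : ∀ t → 2 * t + (2 * t + (t + t)) ≡ 2 * (3 * t)
  six = solve-∀
  three : ∀ t → 2 * t + t ≡ 3 * t
  three = solve-∀

ppCompositions-count : ∀ r → r < 2 → ∀ n → NumPPCompositions (suc n * 2 + r) (2 * 3 ^ n)
ppCompositions-count r r<2 n =
  HasSize-resp-⇔ (λ as → ⇔.sym (isPPComposition⇔isPPList (suc (n * 2 + r)) as))
    (subst (HasSize (IsPPList (suc n * 2 + r))) (proj₁ (counts-closed n)) (proj₁ (sizes r r<2 (suc n))))

mainTheorem1 : (n : ℕ) →
    NumPPCompositions (2 * suc n) (2 * 3 ^ n) ×
    NumPPCompositions (2 * suc n + 1) (2 * 3 ^ n)
mainTheorem1 n =
  subst (λ m → NumPPCompositions m (2 * 3 ^ n)) (trans (+-identityʳ _) (*-comm (suc n) 2))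
    (ppCompositions-count 0 (s≤s z≤n) n) ,
  subst (λ m → NumPPCompositions m (2 * 3 ^ n)) (cong (_+ 1) (*-comm (suc n) 2))
    (ppCompositions-count 1 (s≤s (s≤s z≤n)) n)
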